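{- Let $d$ be an integer with $d>1$ and let $z$ be a non-negative integer. Let $m=\lfloor\sqrt[d]{z}\rfloor$ and $$x_d=m-\left\lfloor\frac{\max\bigl(0,\,z-m^d-m^{d-1}\bigr)}{(m+1)^{d-1}-m^{d-1}}\right\rfloor.$$ Then $0\le x_d\le m$.
   Context: $\lfloor t\rfloor$ denotes the floor of a real number $t$; $0^0=1$ is not needed since $d>1$. -}

module Defs where

open import Data.Nat using (ℕ; zero; suc; _+_; _*_; _∸_; _^_; _≤_; _<_; _/_)
open import Data.Integer using (ℤ; +_; _-_)

-- Total natural-number division: a ÷ 0 := 0 (never used in the statement
-- when d > 1, since then the denominator (m+1)^(d-1) - m^(d-1) is positive).
_÷_ : ℕ → ℕ → ℕ
a ÷ zero  = 0
a ÷ suc b = a / suc b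

IsFloorRoot : ℕ → ℕ → ℕ → Set
IsFloorRoot d z m = (m ^ d ≤ z) × (z < (suc m) ^ d)
  where open import Data.Product using (_×_)

-- x_d = m - ⌊ max(0, z - m^d - m^(d-1)) / ((m+1)^(d-1) - m^(d-1)) ⌋, as an integer.
-- max(0, t) for t = z - m^d - m^(d-1) is exactly truncated subtraction ∸ on ℕ.
xd : ℕ → ℕ → ℕ → ℤ
xd d z m = + m - + ((z ∸ m ^ d ∸ m ^ (d ∸ 1)) ÷ ((suc m) ^ (d ∸ 1) ∸ m ^ (d ∸ 1)))

module Submission where

-- Write d = e + 1 with e ≥ 1, set a = m + 1, and let
--   N = max(0, z - m^d - m^e)   and   D = a^e - m^e,
-- so that x_d = m - ⌊N / D⌋.  The lower bound x_d ≥ 0 amounts to ⌊N / D⌋ ≤ m,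
-- i.e. N < a * D; the upper bound x_d ≤ m holds because ⌊N / D⌋ ≥ 0.
--
-- The key identity is a * D = a^d - (m^d + m^e), while m^d + m^e < a^d
-- (since m^e < a^e when e ≥ 1).  As z < a^d by the definition of m,
-- truncated subtraction of m^d + m^e from both sides preserves the strict
-- inequality, giving N < a * D.

open import Defs
open import Data.Nat using (ℕ; _<_)
open import Data.Integer using (+_) renaming (_≤_ to _≤ℤ_)
open import Data.Product using (_×_; _,_)
open import Data.Nat using (zero; suc; _+_; _*_; _∸_; _^_; _≤_; NonZero; s≤s; z≤n; _≤?_; s≤s⁻¹)
open import Data.Nat.Properties
open import Data.Nat.DivMod using (m<n*o⇒m/o<n)
import Data.Integer as ℤ
import Data.Integer.Properties as ℤ
open import Relation.Binary.PropositionalEquality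
  using (_≡_; cong; subst; subst₂; sym; trans; module ≡-Reasoning)
open import Relation.Nullary using (yes; no; contradiction)

÷-< : ∀ {a b c} → a < b * c → a ÷ c < b
÷-< {a} {b} {zero}  a<b*0 = contradiction (subst (a <_) (*-zeroʳ b) a<b*0) n≮0
÷-< {c = suc _}     a<b*c = m<n*o⇒m/o<n a<b*c

-- Truncated subtraction of s preserves z < A, provided s < A as well
-- (if s > z the left side is 0, and 0 < A - s).
∸-<-∸ : ∀ {z s A} → z < A → s < A → z ∸ s < A ∸ s
∸-<-∸ {z} {s} {A} z<A s<A with s ≤? z
... | yes s≤z = ∸-monoˡ-< z<A s≤z
... | no  s≰z = subst (_< A ∸ s) (sym (m≤n⇒m∸n≡0 (<⇒≤ (≰⇒> s≰z)))) (m<n⇒0<n∸m s<A)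

power-sum-< : ∀ m e .{{_ : NonZero e}} → m ^ suc e + m ^ e < suc m ^ suc e
power-sum-< m e = begin-strict
    m * m ^ e + m ^ e       ≡⟨ +-comm (m * m ^ e) (m ^ e) ⟩
    m ^ e + m * m ^ e       <⟨ +-mono-<-≤ mᵉ<aᵉ (*-monoʳ-≤ m (<⇒≤ mᵉ<aᵉ)) ⟩
    suc m ^ e + m * suc m ^ e ∎
  where
  open ≤-Reasoning
  mᵉ<aᵉ : m ^ e < suc m ^ e
  mᵉ<aᵉ = ^-monoˡ-< e (n<1+n m)

scaled-power-gap : ∀ m e →
  suc m * (suc m ^ e ∸ m ^ e) ≡ suc m ^ suc e ∸ (m ^ suc e + m ^ e)
scaled-power-gap m e = begin
    suc m * (suc m ^ e ∸ m ^ e)            ≡⟨ *-distribˡ-∸ (suc m) (suc m ^ e) (m ^ e) ⟩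
    suc m ^ suc e ∸ (m ^ e + m * m ^ e)    ≡⟨ cong (suc m ^ suc e ∸_) (+-comm (m ^ e) (m * m ^ e)) ⟩
    suc m ^ suc e ∸ (m ^ suc e + m ^ e)    ∎
  where open ≡-Reasoning

quotient-≤ : ∀ z m e .{{_ : NonZero e}} → z < suc m ^ suc e →
  (z ∸ m ^ suc e ∸ m ^ e) ÷ (suc m ^ e ∸ m ^ e) ≤ m
quotient-≤ z m e z<aᵈ = s≤s⁻¹ (÷-< excess<aD)
  where
  excess<aD : z ∸ m ^ suc e ∸ m ^ e < suc m * (suc m ^ e ∸ m ^ e)
  excess<aD = subst₂ _<_ (sym (∸-+-assoc z (m ^ suc e) (m ^ e))) (sym (scaled-power-gap m e))
                (∸-<-∸ z<aᵈ (power-sum-< m e))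

difference-bounds : ∀ {m q} → q ≤ m → (+ 0 ≤ℤ + m ℤ.- + q) × (+ m ℤ.- + q ≤ℤ + m)
difference-bounds {m} {q} q≤m = subst (+ 0 ≤ℤ_) (sym m-q≡m∸q) (ℤ.+≤+ z≤n) , ℤ.i-j≤i (+ m) (+ q)
  where
  m-q≡m∸q : + m ℤ.- + q ≡ + (m ∸ q)
  m-q≡m∸q = trans (ℤ.m-n≡m⊖n m q) (ℤ.⊖-≥ q≤m)

lemma14 : (d z m : ℕ) → 1 < d → IsFloorRoot d z m →
    (+ 0 ≤ℤ xd d z m) × (xd d z m ≤ℤ + m)
lemma14 (suc (suc k)) z m (s≤s (s≤s z≤n)) (_ , z<aᵈ) = difference-bounds (quotient-≤ z m (suc k) z<aᵈ)
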